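{- Let $G$ be the infinite grid graph with vertex set $\mathbb{Z}^2$, let $\tau$ be a face (unit square) of $G$ and $k$ a positive integer, and let $f$ be the flow configuration consisting of $k$ units of flow circulating around $\tau$ (each of the four edges of $\tau$ carries $k$ units of flow in the direction of a fixed cyclic traversal of the boundary of $\tau$, and all other edges carry $0$). Then every run of the flow-firing process started from $f$ terminates after finitely many steps.
   Context: Each edge of $G$ is oriented from South to North or from West to East. A flow configuration assigns an integer $f_e$ to each edge $e$; $f_e>0$ means $f_e$ units along the orientation of $e$, $f_e<0$ means $|f_e|$ units against it. Each edge lies in exactly two faces (unit squares). Rerouting one unit of flow on an edge $e$ across a face $\sigma\ni e$ means replacing one unit of flow along $e$ (in the direction in which flow currently runs on $e$) by one unit of flow along the path formed by the other three edges of $\sigma$ (same endpoints), adding these to existing values (opposite flows cancel). Flow-firing process: at each step choose an edge $e$ with $|f_e|\ge 2$ and fire it, i.e. reroute one unit of its flow across each of the two faces containing $e$. The process terminates when no edge has $|f_e|\ge 2$. -}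

module Defs where

open import Data.Bool using (Bool; true; false; if_then_else_; _∧_)
open import Data.Nat using (ℕ; _≤_)
open import Data.Integer using (ℤ; _+_; _-_; _*_; -_; ∣_∣; sign; _◃_; 0ℤ; 1ℤ; -1ℤ; +_)
import Data.Integer as ℤ
open import Data.Sign using (Sign)
open import Data.Product using (_×_; _,_; Σ; ∃)
open import Relation.Nullary.Decidable using (⌊_⌋)
open import Relation.Binary.PropositionalEquality using (_≡_)
open import Induction.WellFounded using (Acc)

-- Edges of the grid graph on ℤ²:
--   horiz x y : (x , y) → (x + 1 , y)   (oriented West to East)
--   vert  x y : (x , y) → (x , y + 1)   (oriented South to North)
data Edge : Set where
  horiz : ℤ → ℤ → Edge
  vert  : ℤ → ℤ → Edge

-- A face (unit square) is named by its lower-left corner (a , b).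
Face : Set
Face = ℤ × ℤ

-- Flow configuration: an integer on each edge (sign relative to orientation).
Flow : Set
Flow = Edge → ℤ

_=ℤ_ : ℤ → ℤ → Bool
m =ℤ n = ⌊ m ℤ.≟ n ⌋

-- Counterclockwise boundary cycle of the face with lower-left corner (a , b):
-- (a,b) → (a+1,b) → (a+1,b+1) → (a,b+1) → (a,b).
-- bd σ e ∈ {1, -1, 0} is the coefficient of edge e in this cycle.
bd : Face → Edge → ℤ
bd (a , b) (horiz x y) =
  if (x =ℤ a) ∧ (y =ℤ b) then 1ℤ
  else if (x =ℤ a) ∧ (y =ℤ (b + 1ℤ)) then -1ℤ
  else 0ℤ
bd (a , b) (vert x y) =
  if (x =ℤ (a + 1ℤ)) ∧ (y =ℤ b) then 1ℤ
  else if (x =ℤ a) ∧ (y =ℤ b) then -1ℤ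
  else 0ℤ

face₁ face₂ : Edge → Face
face₁ (horiz x y) = (x , y)
face₁ (vert x y)  = (x , y)
face₂ (horiz x y) = (x , y - 1ℤ)
face₂ (vert x y)  = (x - 1ℤ , y)

dirOf : Flow → Edge → ℤ
dirOf f e = sign (f e) ◃ 1

-- Rerouting one unit of flow on e (in direction s = dirOf f e) across a face σ ∋ e:
-- remove one unit along e in direction s and add one unit along the other three
-- edges of σ.
reroute : Flow → Edge → Face → Flow
reroute f e σ e' = f e' - (dirOf f e * bd σ e) * bd σ e'

-- Firing e: reroute one unit of its flow across each of the two faces containing e
-- (both reroutings use the direction of the flow on e before firing).
fire : Flow → Edge → Flow
fire f e e' =
  f e' - (dirOf f e * bd (face₁ e) e) * bd (face₁ e) e'
       - (dirOf f e * bd (face₂ e) e) * bd (face₂ e) e'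

_⟵_ : Flow → Flow → Set
g ⟵ f = Σ Edge (λ e → (2 ≤ ∣ f e ∣) × (g ≡ fire f e))

-- Every run of the process started from f terminates after finitely many steps:
-- f is accessible for the (converse) step relation, i.e. there is no infinite run.
Terminates : Flow → Set
Terminates f = Acc _⟵_ f

-- k units circulating around τ along the fixed cyclic traversal given by o
-- (o = + : counterclockwise, o = - : clockwise); all other edges carry 0.
circulation : Face → Sign → ℕ → Flow
circulation τ o k e = (o ◃ k) * bd τ e

module Submission where

-- A height function h (integers on faces, finitely supported) induces the flow
--   ∂h e = h(face₁ e)·bd(face₁ e) e + h(face₂ e)·bd(face₂ e) e,
-- and the circulation of k units around τ is ∂ of k times the indicator of τ.
-- Firing e changes h only on the two faces σᵢ of e, lowering it by s·cᵢ where
-- s is the sign of f e and cᵢ = bd σᵢ e = ±1.  Since s·(c₁h₁ + c₂h₂) = |f e|,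
-- the energy E = Σ h² changes by (h₁ - s c₁)² + (h₂ - s c₂)² - h₁² - h₂²
-- = 2 - 2|f e| ≤ -2.  As E ≥ 0, every run terminates.

open import Defs
open import Data.Nat using (ℕ; _≥_)
open import Data.Sign using (Sign)

import Data.Nat as ℕ
import Data.Nat.Properties as ℕP
open import Data.Bool using (true; false; if_then_else_; _∧_)
open import Data.Bool.Properties using (∧-zeroʳ)
open import Data.Integer using (ℤ; _+_; _-_; _*_; ∣_∣; sign; _◃_; 0ℤ; 1ℤ; -1ℤ; +_; -[1+_])
import Data.Integer as ℤ
import Data.Integer.Properties as ℤP
open import Data.Integer.Tactic.RingSolver using (solve-∀)
open import Data.Product using (_×_; _,_; Σ; proj₁; proj₂)
open import Data.Product.Properties using (≡-dec)
open import Data.Sum using (_⊎_; inj₁; inj₂)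
open import Data.List using (List; []; _∷_)
open import Data.List.Relation.Unary.All using (All; []; _∷_)
import Data.List.Relation.Unary.All as All
open import Data.List.Relation.Unary.Any using (here; there)
open import Data.List.Relation.Unary.Unique.Propositional using (Unique; []; _∷_)
open import Data.List.Membership.Propositional using (_∈_; _∉_)
open import Data.List.Relation.Binary.Subset.Propositional using (_⊆_)
open import Data.Empty using (⊥-elim)
open import Relation.Nullary using (Dec; yes; no)
open import Relation.Nullary.Decidable using (⌊_⌋)
open import Relation.Binary.PropositionalEquality
open import Induction.WellFounded using (Acc; acc)
open import Data.Nat.Induction using (<-wellFounded)

_≟F_ : (σ τ : Face) → Dec (σ ≡ τ)
_≟F_ = ≡-dec ℤP._≟_ ℤP._≟_

open import Data.List.Membership.DecPropositional _≟F_ using (_∈?_)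

=ℤ-true : ∀ {x y} → x ≡ y → (x =ℤ y) ≡ true
=ℤ-true {x} {y} x≡y with x ℤP.≟ y
... | yes _   = refl
... | no x≢y = ⊥-elim (x≢y x≡y)

=ℤ-false : ∀ {x y} → x ≢ y → (x =ℤ y) ≡ false
=ℤ-false {x} {y} x≢y with x ℤP.≟ y
... | yes x≡y = ⊥-elim (x≢y x≡y)
... | no _    = refl

x≢x+1 : ∀ x → x ≢ x + 1ℤ
x≢x+1 x eq = ℤP.i≢suc[i] (trans eq (ℤP.+-comm x 1ℤ))

x+1-1≡x : ∀ x → (x + 1ℤ) - 1ℤ ≡ x
x+1-1≡x = solve-∀

x-1+1≡x : ∀ x → (x - 1ℤ) + 1ℤ ≡ x
x-1+1≡x = solve-∀

x≢x-1 : ∀ x → x ≢ x - 1ℤ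
x≢x-1 x eq = x≢x+1 (x - 1ℤ) (trans (sym eq) (sym (x-1+1≡x x)))

δ : Face → Face → ℤ
δ σ τ = if ⌊ σ ≟F τ ⌋ then 1ℤ else 0ℤ

δ-same : ∀ σ → δ σ σ ≡ 1ℤ
δ-same σ with σ ≟F σ
... | yes _   = refl
... | no σ≢σ = ⊥-elim (σ≢σ refl)

δ-diff : ∀ {σ τ} → σ ≢ τ → δ σ τ ≡ 0ℤ
δ-diff {σ} {τ} σ≢τ with σ ≟F τ
... | yes σ≡τ = ⊥-elim (σ≢τ σ≡τ)
... | no _    = refl

face₁≢face₂ : ∀ e → face₁ e ≢ face₂ e
face₁≢face₂ (horiz x y) eq = x≢x-1 y (cong proj₂ eq)
face₁≢face₂ (vert x y)  eq = x≢x-1 x (cong proj₁ eq)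

bd-own-faces : ∀ e → (bd (face₁ e) e ≡ 1ℤ  × bd (face₂ e) e ≡ -1ℤ)
                   ⊎ (bd (face₁ e) e ≡ -1ℤ × bd (face₂ e) e ≡ 1ℤ)
bd-own-faces (horiz x y)
  rewrite =ℤ-true (refl {x = x}) | =ℤ-true (refl {x = y})
        | =ℤ-false (x≢x-1 y) | =ℤ-true (sym (x-1+1≡x y)) = inj₁ (refl , refl)
bd-own-faces (vert x y)
  rewrite =ℤ-true (refl {x = x}) | =ℤ-true (refl {x = y})
        | =ℤ-false (x≢x+1 x) | =ℤ-true (sym (x-1+1≡x x)) = inj₂ (refl , refl)

-- In particular both coefficients square to 1; this is all the energy
-- computation needs.
bd-own-faces-sq : ∀ e → bd (face₁ e) e * bd (face₁ e) e ≡ 1ℤ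
                      × bd (face₂ e) e * bd (face₂ e) e ≡ 1ℤ
bd-own-faces-sq e with bd-own-faces e
... | inj₁ (c₁ , c₂) rewrite c₁ | c₂ = refl , refl
... | inj₂ (c₁ , c₂) rewrite c₁ | c₂ = refl , refl

bd-other-face : ∀ σ e → σ ≢ face₁ e → σ ≢ face₂ e → bd σ e ≡ 0ℤ
bd-other-face (a , b) (horiz x y) ≢₁ ≢₂ with x ℤP.≟ a
... | no _ = refl
... | yes refl with y ℤP.≟ b
...   | yes refl = ⊥-elim (≢₁ refl)
...   | no _ with y ℤP.≟ (b + 1ℤ)
...     | yes refl = ⊥-elim (≢₂ (cong (x ,_) (sym (x+1-1≡x b))))
...     | no _ = refl
bd-other-face (a , b) (vert x y) ≢₁ ≢₂ with y ℤP.≟ b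
... | no _ rewrite ∧-zeroʳ (x =ℤ (a + 1ℤ)) | ∧-zeroʳ (x =ℤ a) = refl
... | yes refl with x ℤP.≟ a
...   | yes refl = ⊥-elim (≢₁ refl)
...   | no _ with x ℤP.≟ (a + 1ℤ)
...     | yes refl = ⊥-elim (≢₂ (cong (_, y) (sym (x+1-1≡x a))))
...     | no _ = refl

∂ : (Face → ℤ) → Flow
∂ h e = h (face₁ e) * bd (face₁ e) e + h (face₂ e) * bd (face₂ e) e

∂-δ : ∀ σ e → ∂ (δ σ) e ≡ bd σ e
∂-δ σ e with σ ≟F face₁ e
... | yes refl rewrite δ-diff (face₁≢face₂ e) = left-unit (bd σ e) (bd (face₂ e) e)
  where
  left-unit : ∀ u v → 1ℤ * u + 0ℤ * v ≡ u
  left-unit = solve-∀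
... | no σ≢σ₁ with σ ≟F face₂ e
...   | yes refl = right-unit (bd (face₁ e) e) (bd σ e)
  where
  right-unit : ∀ u v → 0ℤ * u + 1ℤ * v ≡ v
  right-unit = solve-∀
...   | no σ≢σ₂ rewrite bd-other-face σ e σ≢σ₁ σ≢σ₂ = refl

lower : (Face → ℤ) → Face → ℤ → Face → ℤ
lower h σ t τ = h τ - t * δ σ τ

lower-at : ∀ h σ t → lower h σ t σ ≡ h σ - t
lower-at h σ t rewrite δ-same σ = cong (λ x → h σ - x) (ℤP.*-identityʳ t)

lower-off : ∀ h {σ τ} t → σ ≢ τ → lower h σ t τ ≡ h τ
lower-off h {τ = τ} t σ≢τ rewrite δ-diff σ≢τ = minus-zero (h τ) t
  where
  minus-zero : ∀ x t → x - t * 0ℤ ≡ x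
  minus-zero = solve-∀

-- ∂ is linear, so lowering h at σ subtracts a multiple of the cycle of σ.
∂-lower : ∀ h σ t e → ∂ (lower h σ t) e ≡ ∂ h e - t * bd σ e
∂-lower h σ t e = begin
  ∂ (lower h σ t) e
    ≡⟨ expand (h (face₁ e)) (h (face₂ e)) t (δ σ (face₁ e)) (δ σ (face₂ e))
              (bd (face₁ e) e) (bd (face₂ e) e) ⟩
  ∂ h e - t * ∂ (δ σ) e
    ≡⟨ cong (λ c → ∂ h e - t * c) (∂-δ σ e) ⟩
  ∂ h e - t * bd σ e ∎
  where
  open ≡-Reasoning
  expand : ∀ h₁ h₂ t d₁ d₂ c₁ c₂ →
           (h₁ - t * d₁) * c₁ + (h₂ - t * d₂) * c₂ ≡ (h₁ * c₁ + h₂ * c₂) - t * (d₁ * c₁ + d₂ * c₂)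
  expand = solve-∀

sumOver : List Face → (Face → ℤ) → ℤ
sumOver []       F = 0ℤ
sumOver (σ ∷ σs) F = F σ + sumOver σs F

sumOver-cong : ∀ L {F G : Face → ℤ} → All (λ σ → F σ ≡ G σ) L → sumOver L F ≡ sumOver L G
sumOver-cong []       []         = refl
sumOver-cong (σ ∷ σs) (eq ∷ eqs) = cong₂ _+_ eq (sumOver-cong σs eqs)

sumOver-update : ∀ L {σ} {F G : Face → ℤ} → Unique L → σ ∈ L →
                 (∀ τ → τ ≢ σ → G τ ≡ F τ) → sumOver L G ≡ sumOver L F - F σ + G σ
sumOver-update (σ ∷ σs) {F = F} {G} (σ≢σs ∷ _) (here refl) agree
  rewrite sumOver-cong σs {G} {F} (All.map (λ σ≢τ → agree _ (λ eq → σ≢τ (sym eq))) σ≢σs)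
  = replace-head (G σ) (sumOver σs F) (F σ)
  where
  replace-head : ∀ g S f → g + S ≡ f + S - f + g
  replace-head = solve-∀
sumOver-update (τ ∷ τs) {σ} {F} {G} (τ≢τs ∷ uniq) (there σ∈) agree
  rewrite agree τ (All.lookup τ≢τs σ∈) | sumOver-update τs uniq σ∈ agree
  = reassociate (F τ) (sumOver τs F) (F σ) (G σ)
  where
  reassociate : ∀ f S x y → f + (S - x + y) ≡ f + S - x + y
  reassociate = solve-∀

energyOn : List Face → (Face → ℤ) → ℤ
energyOn L h = sumOver L (λ σ → h σ * h σ)

square-nonneg : ∀ z → 0ℤ ℤ.≤ z * z
square-nonneg (+ n) rewrite sym (ℤP.pos-* n n) = ℤ.+≤+ ℕ.z≤n
square-nonneg -[1+ n ] = ℤ.+≤+ ℕ.z≤n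

energyOn-nonneg : ∀ L h → 0ℤ ℤ.≤ energyOn L h
energyOn-nonneg []       h = ℤP.≤-refl
energyOn-nonneg (σ ∷ σs) h = ℤP.+-mono-≤ (square-nonneg (h σ)) (energyOn-nonneg σs h)

energyOn-lower : ∀ L h σ t → Unique L → σ ∈ L →
                 energyOn L (lower h σ t) ≡ energyOn L h - h σ * h σ + (h σ - t) * (h σ - t)
energyOn-lower L h σ t uniq σ∈ =
  subst (λ x → energyOn L (lower h σ t) ≡ energyOn L h - h σ * h σ + x * x) (lower-at h σ t)
        (sumOver-update L uniq σ∈ agree)
  where
  agree : ∀ τ → τ ≢ σ → lower h σ t τ * lower h σ t τ ≡ h τ * h τ
  agree τ τ≢σ = cong (λ x → x * x) (lower-off h t (λ eq → τ≢σ (sym eq)))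

record Support (h : Face → ℤ) : Set where
  field
    faces   : List Face
    unique  : Unique faces
    vanish  : ∀ σ → σ ∉ faces → h σ ≡ 0ℤ
open Support

lower-support : ∀ {h} (S : Support h) {σ} t → σ ∈ faces S → Support (lower h σ t)
lower-support {h} S {σ} t σ∈ = record
  { faces = faces S ; unique = unique S ; vanish = vanish′ }
  where
  vanish′ : ∀ τ → τ ∉ faces S → lower h σ t τ ≡ 0ℤ
  vanish′ τ τ∉ = trans (lower-off h t (λ { refl → τ∉ σ∈ })) (vanish S τ τ∉)

enlarge : ∀ {h} (S : Support h) σ →
          Σ (Support h) λ S′ → σ ∈ faces S′ × faces S ⊆ faces S′
                             × energyOn (faces S′) h ≡ energyOn (faces S) h
enlarge {h} S σ with σ ∈? faces S
... | yes σ∈ = S , σ∈ , (λ τ∈ → τ∈) , refl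
... | no σ∉ = record { faces = σ ∷ faces S ; unique = fresh ∷ unique S ; vanish = vanish′ }
            , here refl , there , energy-same
  where
  fresh : All (σ ≢_) (faces S)
  fresh = All.tabulate (λ { τ∈ refl → σ∉ τ∈ })
  vanish′ : ∀ τ → τ ∉ σ ∷ faces S → h τ ≡ 0ℤ
  vanish′ τ τ∉ = vanish S τ (λ τ∈ → τ∉ (there τ∈))
  energy-same : h σ * h σ + energyOn (faces S) h ≡ energyOn (faces S) h
  energy-same rewrite vanish S σ σ∉ = ℤP.+-identityˡ _

record Height (f : Flow) : Set where
  field
    height   : Face → ℤ
    support  : Support height
    boundary : ∀ e → f e ≡ ∂ height e
open Height

energy : ∀ {f} → Height f → ℤ
energy H = energyOn (faces (support H)) (height H)

-- The algebraic heart of the energy drop: with c₁² = c₂² = 1 and s² = 1,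
--   (h₁ - s c₁)² + (h₂ - s c₂)² + 2 s (h₁ c₁ + h₂ c₂) = h₁² + h₂² + 2.
square-shift : ∀ h₁ h₂ s c₁ c₂ → s * s ≡ 1ℤ → c₁ * c₁ ≡ 1ℤ → c₂ * c₂ ≡ 1ℤ →
               (h₁ - s * c₁) * (h₁ - s * c₁) + (h₂ - s * c₂) * (h₂ - s * c₂)
                 + + 2 * (s * (h₁ * c₁ + h₂ * c₂))
               ≡ h₁ * h₁ + h₂ * h₂ + + 2
square-shift h₁ h₂ s c₁ c₂ ss c₁c₁ c₂c₂ = begin
  (h₁ - s * c₁) * (h₁ - s * c₁) + (h₂ - s * c₂) * (h₂ - s * c₂) + + 2 * (s * (h₁ * c₁ + h₂ * c₂))
    ≡⟨ expand h₁ h₂ s c₁ c₂ ⟩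
  h₁ * h₁ + h₂ * h₂ + ((s * s) * (c₁ * c₁) + (s * s) * (c₂ * c₂))
    ≡⟨ cong (λ x → h₁ * h₁ + h₂ * h₂ + x)
            (cong₂ _+_ (cong₂ _*_ ss c₁c₁) (cong₂ _*_ ss c₂c₂)) ⟩
  h₁ * h₁ + h₂ * h₂ + + 2 ∎
  where
  open ≡-Reasoning
  expand : ∀ h₁ h₂ s c₁ c₂ →
           (h₁ - s * c₁) * (h₁ - s * c₁) + (h₂ - s * c₂) * (h₂ - s * c₂)
             + + 2 * (s * (h₁ * c₁ + h₂ * c₂))
           ≡ h₁ * h₁ + h₂ * h₂ + ((s * s) * (c₁ * c₁) + (s * s) * (c₂ * c₂))
  expand = solve-∀

sign-sq : ∀ z → (sign z ◃ 1) * (sign z ◃ 1) ≡ 1ℤ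
sign-sq (+ n)    = refl
sign-sq -[1+ n ] = refl

sign-times : ∀ z → (sign z ◃ 1) * z ≡ + ∣ z ∣
sign-times (+ n)    = ℤP.*-identityˡ (+ n)
sign-times -[1+ n ] = ℤP.-1*i≡-i -[1+ n ]

-- Firing e from ∂h, where the support of h contains both faces of e: lowering
-- h at face₁ e and face₂ e by s·bd(σᵢ) e gives a height function of the fired
-- flow whose energy is lower by 2|f e| - 2.
fire-lowering : ∀ {f} h (S : Support h) e → (∀ e′ → f e′ ≡ ∂ h e′) →
                face₁ e ∈ faces S → face₂ e ∈ faces S →
                Σ (Height (fire f e)) λ H′ → energy H′ + + 2 * + ∣ f e ∣ ≡ energyOn (faces S) h + + 2
fire-lowering {f} h S e f≡∂h σ₁∈ σ₂∈ = H′ , energy-drop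
  where
  σ₁ σ₂ : Face
  σ₁ = face₁ e
  σ₂ = face₂ e
  s t₁ t₂ : ℤ
  s  = dirOf f e
  t₁ = s * bd σ₁ e
  t₂ = s * bd σ₂ e

  h₁ h′ : Face → ℤ
  h₁ = lower h σ₁ t₁
  h′ = lower h₁ σ₂ t₂

  h′-boundary : ∀ e′ → fire f e e′ ≡ ∂ h′ e′
  h′-boundary e′ = sym (begin
    ∂ h′ e′                                    ≡⟨ ∂-lower h₁ σ₂ t₂ e′ ⟩
    ∂ h₁ e′ - t₂ * bd σ₂ e′                    ≡⟨ cong (_- t₂ * bd σ₂ e′) (∂-lower h σ₁ t₁ e′) ⟩
    ∂ h e′ - t₁ * bd σ₁ e′ - t₂ * bd σ₂ e′     ≡⟨ cong (λ x → x - t₁ * bd σ₁ e′ - t₂ * bd σ₂ e′)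
                                                        (sym (f≡∂h e′)) ⟩
    fire f e e′                                ∎)
    where open ≡-Reasoning

  H′ : Height (fire f e)
  H′ = record
    { height   = h′
    ; support  = lower-support (lower-support S t₁ σ₁∈) t₂ σ₂∈
    ; boundary = h′-boundary }

  A a₁ a₂ b₁ b₂ : ℤ
  A  = + ∣ f e ∣
  a₁ = h σ₁ * h σ₁
  a₂ = h σ₂ * h σ₂
  b₁ = (h σ₁ - t₁) * (h σ₁ - t₁)
  b₂ = (h σ₂ - t₂) * (h σ₂ - t₂)

  step₁ : energyOn (faces S) h₁ ≡ energyOn (faces S) h - a₁ + b₁
  step₁ = energyOn-lower (faces S) h σ₁ t₁ (unique S) σ₁∈
  step₂ : energy H′ ≡ energyOn (faces S) h₁ - a₂ + b₂
  step₂ = subst (λ x → energy H′ ≡ energyOn (faces S) h₁ - x * x + (x - t₂) * (x - t₂))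
                (lower-off h t₁ (face₁≢face₂ e))
                (energyOn-lower (faces S) h₁ σ₂ t₂ (unique S) σ₂∈)

  local-change : b₁ + b₂ + + 2 * A ≡ a₁ + a₂ + + 2
  local-change = subst (λ x → b₁ + b₂ + + 2 * x ≡ a₁ + a₂ + + 2)
                       (trans (cong (s *_) (sym (f≡∂h e))) (sign-times (f e)))
                       (square-shift (h σ₁) (h σ₂) s (bd σ₁ e) (bd σ₂ e) (sign-sq (f e))
                          (proj₁ (bd-own-faces-sq e)) (proj₂ (bd-own-faces-sq e)))

  energy-drop : energy H′ + + 2 * A ≡ energyOn (faces S) h + + 2
  energy-drop = begin
    energy H′ + + 2 * A                   ≡⟨ cong (_+ + 2 * A) step₂ ⟩
    E₁ - a₂ + b₂ + + 2 * A                ≡⟨ cong (λ x → x - a₂ + b₂ + + 2 * A) step₁ ⟩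
    E - a₁ + b₁ - a₂ + b₂ + + 2 * A       ≡⟨ regroup E a₁ a₂ b₁ b₂ A ⟩
    E - (a₁ + a₂) + (b₁ + b₂ + + 2 * A)   ≡⟨ cong (λ x → E - (a₁ + a₂) + x) local-change ⟩
    E - (a₁ + a₂) + (a₁ + a₂ + + 2)       ≡⟨ cancel E (a₁ + a₂) ⟩
    E + + 2                               ∎
    where
    open ≡-Reasoning
    E E₁ : ℤ
    E  = energyOn (faces S) h
    E₁ = energyOn (faces S) h₁
    regroup : ∀ E a₁ a₂ b₁ b₂ A → E - a₁ + b₁ - a₂ + b₂ + + 2 * A ≡ E - (a₁ + a₂) + (b₁ + b₂ + + 2 * A)
    regroup = solve-∀
    cancel : ∀ E a → E - a + (a + + 2) ≡ E + + 2
    cancel = solve-∀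

fire-height : ∀ {f} (H : Height f) e →
              Σ (Height (fire f e)) λ H′ → energy H′ + + 2 * + ∣ f e ∣ ≡ energy H + + 2
fire-height {f} H e with enlarge (support H) (face₂ e)
... | S₂ , σ₂∈S₂ , _ , E₂≡E with enlarge S₂ (face₁ e)
...   | S , σ₁∈S , S₂⊆S , E≡E₂ =
  subst (λ E → Σ (Height (fire f e)) λ H′ → energy H′ + + 2 * + ∣ f e ∣ ≡ E + + 2)
        (trans E≡E₂ E₂≡E)
        (fire-lowering (height H) S e (boundary H) σ₁∈S (S₂⊆S σ₂∈S₂))

drop⇒< : ∀ m′ m a → 2 ℕ.≤ a → + m′ + + 2 * + a ≡ + m + + 2 → m′ ℕ.< m
drop⇒< m′ m a 2≤a eq = ℕP.+-cancelʳ-< 2 m′ m (begin-strict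
  m′ ℕ.+ 2        <⟨ ℕP.+-monoʳ-< m′ (ℕ.s≤s (ℕ.s≤s (ℕ.s≤s ℕ.z≤n))) ⟩
  m′ ℕ.+ 4        ≤⟨ ℕP.+-monoʳ-≤ m′ (ℕP.*-monoʳ-≤ 2 2≤a) ⟩
  m′ ℕ.+ 2 ℕ.* a  ≡⟨ ℤP.+-injective eq-in-ℤ ⟩
  m ℕ.+ 2         ∎)
  where
  open ℕP.≤-Reasoning
  eq-in-ℤ : + (m′ ℕ.+ 2 ℕ.* a) ≡ + (m ℕ.+ 2)
  eq-in-ℤ = trans (ℤP.pos-+ m′ (2 ℕ.* a))
           (trans (cong (λ x → + m′ + x) (ℤP.pos-* 2 a))
           (trans eq (sym (ℤP.pos-+ m 2))))

energy-nonneg : ∀ {f} (H : Height f) → energy H ≡ + ∣ energy H ∣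
energy-nonneg H = sym (ℤP.0≤i⇒+∣i∣≡i (energyOn-nonneg (faces (support H)) (height H)))

energy-decreases : ∀ {f} (H : Height f) e → 2 ℕ.≤ ∣ f e ∣ →
                   ∣ energy (proj₁ (fire-height H e)) ∣ ℕ.< ∣ energy H ∣
energy-decreases {f} H e 2≤ = drop⇒< _ _ (∣ f e ∣) 2≤
  (subst₂ (λ E′ E → E′ + + 2 * + ∣ f e ∣ ≡ E + + 2)
          (energy-nonneg H′) (energy-nonneg H) (proj₂ (fire-height H e)))
  where
  H′ : Height (fire f e)
  H′ = proj₁ (fire-height H e)

height⇒terminates : ∀ {f} → Height f → Terminates f
height⇒terminates H = go H (<-wellFounded _)
  where
  go : ∀ {f} (H : Height f) → Acc ℕ._<_ ∣ energy H ∣ → Terminates f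
  go H (acc smaller) = acc λ { (e , 2≤ , refl) →
    go (proj₁ (fire-height H e)) (smaller (energy-decreases H e 2≤)) }

cycle-height : ∀ τ c → Height (λ e → c * bd τ e)
cycle-height τ c = record
  { height   = λ σ → c * δ τ σ
  ; support  = record { faces = τ ∷ [] ; unique = [] ∷ [] ; vanish = vanish′ }
  ; boundary = λ e → trans (cong (c *_) (sym (∂-δ τ e)))
                           (factor c (δ τ (face₁ e)) (δ τ (face₂ e)) (bd (face₁ e) e) (bd (face₂ e) e)) }
  where
  vanish′ : ∀ σ → σ ∉ τ ∷ [] → c * δ τ σ ≡ 0ℤ
  vanish′ σ σ∉ = trans (cong (c *_) (δ-diff (λ τ≡σ → σ∉ (here (sym τ≡σ))))) (ℤP.*-zeroʳ c)
  factor : ∀ c d₁ d₂ b₁ b₂ → c * (d₁ * b₁ + d₂ * b₂) ≡ c * d₁ * b₁ + c * d₂ * b₂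
  factor = solve-∀

corollary5p3 : (τ : Face) (o : Sign) (k : ℕ) → k ≥ 1 → Terminates (circulation τ o k)
corollary5p3 τ o k _ = height⇒terminates (cycle-height τ (o ◃ k))
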